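{- Let $G=(V,E)$ be a simple graph with $V=\{1,\dots,n\}$, adjacency matrix $A$, and let $\mathrm{SOL}(G)$ be the solution set of $\mathrm{LCP}(A+I,-\mathbf{e})$. Then: (a) $0\notin \mathrm{SOL}(G)$; (b) $(A+I)x\geq x$ for all $x\in\mathrm{SOL}(G)$; (c) $\mathrm{SOL}(G)\subseteq[0,1]^n$; (d) if $G$ is the disjoint union of graphs $G_1$ and $G_2$, then $\mathrm{SOL}(G)=\mathrm{SOL}(G_1)\times\mathrm{SOL}(G_2)$ (with coordinates split according to the vertices of $G_1$ and $G_2$); (e) if $x\in\mathrm{SOL}(G)$, then $\sigma(x)$ is a dominating set of $G$; (f) if $x\in\mathrm{SOL}(G)$, then the subvector $\hat x=x_{\sigma(x)}$ lies in $\mathrm{SOL}(G_{\sigma(x)})$ and $\sigma(\hat x)=V(G_{\sigma(x)})$.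
   Context: $I$ is the identity matrix and $\mathbf{e}$ the all-ones vector. A vector $x$ solves $\mathrm{LCP}(A+I,-\mathbf{e})$ if $x\ge0$, $(A+I)x\ge\mathbf{e}$, $x^\top((A+I)x-\mathbf{e})=0$; for any graph $H$, $\mathrm{SOL}(H)$ denotes the solution set of this LCP built from the adjacency matrix of $H$. The support of $x$ is $\sigma(x)=\{i\in V\mid x_i>0\}$. For $S\subseteq V$, $G_S$ is the induced subgraph on $S$ and $x_S$ the subvector of $x$ indexed by $S$. A set $S$ is dominating if every vertex not in $S$ has a neighbour in $S$.
   Formalization: The vectors x in $\mathrm{SOL}(G)$, and in the solution sets of the graphs in (d) and (f), have rational entries instead of real ones. -}

module Defs where

open import Data.Nat using (ℕ; zero; suc)
import Data.Nat as ℕ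
open import Data.Fin using (Fin; zero; suc; splitAt; _↑ˡ_; _↑ʳ_)
open import Data.Bool using (Bool; true; false; if_then_else_)
open import Data.Sum using (_⊎_; inj₁; inj₂)
open import Data.Product using (_×_; ∃; Σ; _,_)
open import Data.List using (List; filter; length; lookup; allFin)
open import Data.Rational using (ℚ; 0ℚ; 1ℚ; _+_; _*_; _-_; _≤_; _<_)
open import Data.Rational.Properties using (_<?_)
open import Relation.Binary.PropositionalEquality using (_≡_; refl)

record Graph (n : ℕ) : Set where
  field
    adj   : Fin n → Fin n → Bool
    sym   : ∀ i j → adj i j ≡ adj j i
    irref : ∀ i → adj i i ≡ false
open Graph public

Vecℚ : ℕ → Set
Vecℚ n = Fin n → ℚ

sumℚ : ∀ {n} → (Fin n → ℚ) → ℚ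
sumℚ {zero}  f = 0ℚ
sumℚ {suc n} f = f zero + sumℚ (λ i → f (suc i))

A : ∀ {n} → Graph n → Fin n → Fin n → ℚ
A G i j = if adj G i j then 1ℚ else 0ℚ

AIx : ∀ {n} → Graph n → Vecℚ n → Vecℚ n
AIx G x i = sumℚ (λ j → A G i j * x j) + x i

SOL : ∀ {n} → Graph n → Vecℚ n → Set
SOL G x = (∀ i → 0ℚ ≤ x i)
        × (∀ i → 1ℚ ≤ AIx G x i)
        × (sumℚ (λ i → x i * (AIx G x i - 1ℚ)) ≡ 0ℚ)

σ : ∀ {n} → Vecℚ n → Fin n → Set
σ x i = 0ℚ < x i

Dominating : ∀ {n} → Graph n → (Fin n → Set) → Set
Dominating G S = ∀ v → S v ⊎ ∃ λ u → (adj G v u ≡ true) × S u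

-- Disjoint union G₁ ⊔ G₂ on Fin (n₁ + n₂): the vertices of G₁ come first
-- (i ↦ i ↑ˡ n₂), then those of G₂ (j ↦ n₁ ↑ʳ j).
⊔adj : ∀ {n₁ n₂} → Graph n₁ → Graph n₂ → Fin (n₁ ℕ.+ n₂) → Fin (n₁ ℕ.+ n₂) → Bool
⊔adj {n₁} G₁ G₂ i j with splitAt n₁ i | splitAt n₁ j
... | inj₁ a | inj₁ b = adj G₁ a b
... | inj₂ a | inj₂ b = adj G₂ a b
... | inj₁ _ | inj₂ _ = false
... | inj₂ _ | inj₁ _ = false

⊔sym : ∀ {n₁ n₂} (G₁ : Graph n₁) (G₂ : Graph n₂) → ∀ i j → ⊔adj G₁ G₂ i j ≡ ⊔adj G₁ G₂ j i
⊔sym {n₁} G₁ G₂ i j with splitAt n₁ i | splitAt n₁ j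
... | inj₁ a | inj₁ b = sym G₁ a b
... | inj₂ a | inj₂ b = sym G₂ a b
... | inj₁ _ | inj₂ _ = refl
... | inj₂ _ | inj₁ _ = refl

⊔irref : ∀ {n₁ n₂} (G₁ : Graph n₁) (G₂ : Graph n₂) → ∀ i → ⊔adj G₁ G₂ i i ≡ false
⊔irref {n₁} G₁ G₂ i with splitAt n₁ i
... | inj₁ a = irref G₁ a
... | inj₂ a = irref G₂ a

_⊔_ : ∀ {n₁ n₂} → Graph n₁ → Graph n₂ → Graph (n₁ ℕ.+ n₂)
G₁ ⊔ G₂ = record { adj = ⊔adj G₁ G₂ ; sym = ⊔sym G₁ G₂ ; irref = ⊔irref G₁ G₂ }

supportList : ∀ {n} → Vecℚ n → List (Fin n)
supportList {n} x = filter (λ i → 0ℚ <? x i) (allFin n)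

supportSize : ∀ {n} → Vecℚ n → ℕ
supportSize x = length (supportList x)

supportEmb : ∀ {n} (x : Vecℚ n) → Fin (supportSize x) → Fin n
supportEmb x = lookup (supportList x)

-- Induced subgraph along a vertex map e : Fin m → Fin n (used with e injective)
induced : ∀ {m n} → Graph n → (Fin m → Fin n) → Graph m
induced G e = record
  { adj   = λ a b → adj G (e a) (e b)
  ; sym   = λ a b → sym G (e a) (e b)
  ; irref = λ a → irref G (e a) }

Gσ : ∀ {n} → Graph n → (x : Vecℚ n) → Graph (supportSize x)
Gσ G x = induced G (supportEmb x)

xσ : ∀ {n} (x : Vecℚ n) → Vecℚ (supportSize x)
xσ x k = x (supportEmb x k)

{-# OPTIONS --safe #-}
-- The complementarity sum of a solution is a sum of non-negative terms x i * (((A + I) x)_i - 1),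
-- so it vanishes term by term: x solves the LCP exactly when every coordinate is complementary
-- (x i ≥ 0, ((A + I) x)_i ≥ 1, and one of the two is tight). Everything then follows coordinatewise:
-- x i > 1 would force ((A + I) x)_i ≥ x i > 1; a vertex outside the support has (A x)_i ≥ 1 and
-- hence a neighbour in the support; and the rows of (A + I) x do not change when a disjoint union
-- is split or when the coordinates where x vanishes are dropped.
module Submission where

open import Defs
open import Data.Nat using (ℕ; zero; suc; s≤s; z≤n)
import Data.Nat as ℕ
open import Data.Fin using (Fin; zero; suc; splitAt; _↑ˡ_; _↑ʳ_)
open import Data.Fin.Properties using (splitAt-↑ˡ; splitAt-↑ʳ; splitAt⁻¹-↑ˡ; splitAt⁻¹-↑ʳ)
open import Data.Bool using (true; false)
open import Data.List using ([]; _∷_; filter; tabulate; lookup; allFin)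
open import Data.List.Membership.Propositional.Properties using (∈-filter⁻; ∈-lookup)
open import Data.Product using (_×_; _,_; ∃; proj₁; proj₂; map)
open import Data.Sum using (inj₁; inj₂)
open import Data.Empty using (⊥-elim)
open import Data.Rational using (ℚ; 0ℚ; 1ℚ; _+_; _*_; _-_; -_; _≤_; _<_; positive; nonNegative)
open import Data.Rational.Properties
open import Function using (_∘_; id)
open import Function.Bundles using (_⇔_; mk⇔)
open import Relation.Nullary using (¬_; yes; no)
open import Relation.Unary using (Decidable)
open import Relation.Binary.PropositionalEquality
  using (_≡_; refl; cong; cong₂; subst) renaming (sym to ≡-sym; trans to ≡-trans)

0<1 : 0ℚ < 1ℚ
0<1 = positive⁻¹ 1ℚ

*-nonNeg : ∀ {p q} → 0ℚ ≤ p → 0ℚ ≤ q → 0ℚ ≤ p * q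
*-nonNeg {p} {q} 0≤p 0≤q =
  nonNegative⁻¹ (p * q) {{nonNeg*nonNeg⇒nonNeg p {{nonNegative 0≤p}} q {{nonNegative 0≤q}}}}

*-pos : ∀ {p q} → 0ℚ < p → 0ℚ < q → 0ℚ < p * q
*-pos {p} {q} 0<p 0<q = positive⁻¹ (p * q) {{pos*pos⇒pos p {{positive 0<p}} q {{positive 0<q}}}}

p≤q⇒0≤q-p : ∀ {p q} → p ≤ q → 0ℚ ≤ q - p
p≤q⇒0≤q-p {p} {q} p≤q = subst (_≤ q - p) (+-inverseʳ p) (+-monoˡ-≤ (- p) p≤q)

p<q⇒0<q-p : ∀ {p q} → p < q → 0ℚ < q - p
p<q⇒0<q-p {p} {q} p<q = subst (_< q - p) (+-inverseʳ p) (+-monoˡ-< (- p) p<q)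

p≤p+q : ∀ p {q} → 0ℚ ≤ q → p ≤ p + q
p≤p+q p {q} 0≤q = subst (_≤ p + q) (+-identityʳ p) (+-monoʳ-≤ p 0≤q)

nonNeg+nonNeg≡0 : ∀ {p q} → 0ℚ ≤ p → 0ℚ ≤ q → p + q ≡ 0ℚ → (p ≡ 0ℚ) × (q ≡ 0ℚ)
nonNeg+nonNeg≡0 {p} {q} 0≤p 0≤q p+q≡0 =
    ≤-antisym (subst (p ≤_) p+q≡0 (p≤p+q p 0≤q)) 0≤p
  , ≤-antisym (subst (q ≤_) (≡-trans (+-comm q p) p+q≡0) (p≤p+q q 0≤p)) 0≤q

p[q-1]≡0∧p≤q⇒p≤1 : ∀ {p q} → p * (q - 1ℚ) ≡ 0ℚ → p ≤ q → p ≤ 1ℚ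
p[q-1]≡0∧p≤q⇒p≤1 p[q-1]≡0 p≤q = ≮⇒≥ λ 1<p →
  <-irrefl (≡-sym p[q-1]≡0) (*-pos (<-trans 0<1 1<p) (p<q⇒0<q-p (<-≤-trans 1<p p≤q)))

sumℚ-cong : ∀ {n} {f g : Fin n → ℚ} → (∀ i → f i ≡ g i) → sumℚ f ≡ sumℚ g
sumℚ-cong {zero}  f≡g = refl
sumℚ-cong {suc n} f≡g = cong₂ _+_ (f≡g zero) (sumℚ-cong (f≡g ∘ suc))

sumℚ-zeros : ∀ {n} {f : Fin n → ℚ} → (∀ i → f i ≡ 0ℚ) → sumℚ f ≡ 0ℚ
sumℚ-zeros {zero}  f≡0 = refl
sumℚ-zeros {suc n} f≡0 = ≡-trans (cong₂ _+_ (f≡0 zero) (sumℚ-zeros (f≡0 ∘ suc))) (+-identityˡ 0ℚ)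

sumℚ-nonNeg : ∀ {n} {f : Fin n → ℚ} → (∀ i → 0ℚ ≤ f i) → 0ℚ ≤ sumℚ f
sumℚ-nonNeg {zero}  0≤f = ≤-refl
sumℚ-nonNeg {suc n} {f} 0≤f = subst (_≤ sumℚ f) (+-identityʳ 0ℚ) (+-mono-≤ (0≤f zero) (sumℚ-nonNeg (0≤f ∘ suc)))

sumℚ-nonNeg-≡0 : ∀ {n} {f : Fin n → ℚ} → (∀ i → 0ℚ ≤ f i) → sumℚ f ≡ 0ℚ → ∀ i → f i ≡ 0ℚ
sumℚ-nonNeg-≡0 {suc n} 0≤f Σ≡0 zero    = proj₁ (nonNeg+nonNeg≡0 (0≤f zero) (sumℚ-nonNeg (0≤f ∘ suc)) Σ≡0)
sumℚ-nonNeg-≡0 {suc n} 0≤f Σ≡0 (suc i) =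
  sumℚ-nonNeg-≡0 (0≤f ∘ suc) (proj₂ (nonNeg+nonNeg≡0 (0≤f zero) (sumℚ-nonNeg (0≤f ∘ suc)) Σ≡0)) i

sumℚ-pos⇒∃pos : ∀ {n} (f : Fin n → ℚ) → 0ℚ < sumℚ f → ∃ λ i → 0ℚ < f i
sumℚ-pos⇒∃pos {zero}  f 0<0 = ⊥-elim (<-irrefl refl 0<0)
sumℚ-pos⇒∃pos {suc n} f 0<Σ with 0ℚ <? f zero
... | yes 0<f₀ = zero , 0<f₀
... | no  0≮f₀ = map suc id (sumℚ-pos⇒∃pos (f ∘ suc) 0<Σ′)
  where
  open ≤-Reasoning
  0<Σ′ : 0ℚ < sumℚ (f ∘ suc)
  0<Σ′ = begin-strict
    0ℚ                       <⟨ 0<Σ ⟩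
    f zero + sumℚ (f ∘ suc)  ≤⟨ +-monoˡ-≤ (sumℚ (f ∘ suc)) (≮⇒≥ 0≮f₀) ⟩
    0ℚ + sumℚ (f ∘ suc)      ≡⟨ +-identityˡ _ ⟩
    sumℚ (f ∘ suc)           ∎

sumℚ-↑ : ∀ n₁ {n₂} (f : Fin (n₁ ℕ.+ n₂) → ℚ) → sumℚ f ≡ sumℚ (f ∘ (_↑ˡ n₂)) + sumℚ (f ∘ (n₁ ↑ʳ_))
sumℚ-↑ zero     f = ≡-sym (+-identityˡ (sumℚ f))
sumℚ-↑ (suc n₁) f = ≡-trans (cong (f zero +_) (sumℚ-↑ n₁ (f ∘ suc))) (≡-sym (+-assoc (f zero) _ _))

sumℚ-↑ˡ : ∀ n₁ {n₂} (f : Fin (n₁ ℕ.+ n₂) → ℚ) → (∀ j → f (n₁ ↑ʳ j) ≡ 0ℚ) → sumℚ f ≡ sumℚ (f ∘ (_↑ˡ n₂))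
sumℚ-↑ˡ n₁ {n₂} f f≡0 = ≡-trans (sumℚ-↑ n₁ f) (≡-trans (cong (sumℚ (f ∘ (_↑ˡ n₂)) +_) (sumℚ-zeros f≡0)) (+-identityʳ _))

sumℚ-↑ʳ : ∀ n₁ {n₂} (f : Fin (n₁ ℕ.+ n₂) → ℚ) → (∀ i → f (i ↑ˡ n₂) ≡ 0ℚ) → sumℚ f ≡ sumℚ (f ∘ (n₁ ↑ʳ_))
sumℚ-↑ʳ n₁ f f≡0 = ≡-trans (sumℚ-↑ n₁ f) (≡-trans (cong (_+ sumℚ (f ∘ (n₁ ↑ʳ_))) (sumℚ-zeros f≡0)) (+-identityˡ _))

sumℚ-lookup-tabulate : ∀ {n} {B : Set} (f : B → ℚ) (g : Fin n → B) → sumℚ (f ∘ lookup (tabulate g)) ≡ sumℚ (f ∘ g)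
sumℚ-lookup-tabulate {zero}  f g = refl
sumℚ-lookup-tabulate {suc n} f g = cong (f (g zero) +_) (sumℚ-lookup-tabulate f (g ∘ suc))

sumℚ-lookup-filter : ∀ {B : Set} {P : B → Set} (P? : Decidable P) (f : B → ℚ) → (∀ b → ¬ P b → f b ≡ 0ℚ)
  → ∀ l → sumℚ (f ∘ lookup (filter P? l)) ≡ sumℚ (f ∘ lookup l)
sumℚ-lookup-filter P? f f≡0 []      = refl
sumℚ-lookup-filter P? f f≡0 (b ∷ l) with P? b
... | yes _   = cong (f b +_) (sumℚ-lookup-filter P? f f≡0 l)
... | no  ¬Pb = ≡-trans (sumℚ-lookup-filter P? f f≡0 l)
                  (≡-trans (≡-sym (+-identityˡ _)) (cong (_+ sumℚ (f ∘ lookup l)) (≡-sym (f≡0 b ¬Pb))))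

sumℚ-supportEmb : ∀ {n} (x f : Vecℚ n) → (∀ j → ¬ σ x j → f j ≡ 0ℚ) → sumℚ (f ∘ supportEmb x) ≡ sumℚ f
sumℚ-supportEmb {n} x f f≡0 =
  ≡-trans (sumℚ-lookup-filter (λ i → 0ℚ <? x i) f f≡0 (allFin n)) (sumℚ-lookup-tabulate f id)

σ-xσ : ∀ {n} (x : Vecℚ n) k → σ (xσ x) k
σ-xσ {n} x k = proj₂ (∈-filter⁻ (λ i → 0ℚ <? x i) {xs = allFin n} (∈-lookup {xs = supportList x} k))

↑-elim : ∀ {n₁ n₂} (P : Fin (n₁ ℕ.+ n₂) → Set) → (∀ i → P (i ↑ˡ n₂)) → (∀ j → P (n₁ ↑ʳ j)) → ∀ k → P k
↑-elim {n₁} P Pˡ Pʳ k with splitAt n₁ k in eq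
... | inj₁ i = subst P (splitAt⁻¹-↑ˡ eq) (Pˡ i)
... | inj₂ j = subst P (splitAt⁻¹-↑ʳ eq) (Pʳ j)

A*-nonNeg : ∀ {n} (G : Graph n) i j {y} → 0ℚ ≤ y → 0ℚ ≤ A G i j * y
A*-nonNeg G i j {y} 0≤y with adj G i j
... | true  = subst (0ℚ ≤_) (≡-sym (*-identityˡ y)) 0≤y
... | false = subst (0ℚ ≤_) (≡-sym (*-zeroˡ y)) ≤-refl

A*-pos⇒adj∧pos : ∀ {n} (G : Graph n) {i j y} → 0ℚ < A G i j * y → (adj G i j ≡ true) × (0ℚ < y)
A*-pos⇒adj∧pos G {i} {j} {y} 0<Ay with adj G i j
... | true  = refl , subst (0ℚ <_) (*-identityˡ y) 0<Ay
... | false = ⊥-elim (<-irrefl refl (subst (0ℚ <_) (*-zeroˡ y) 0<Ay))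

AIx-0 : ∀ {n} (G : Graph n) i → AIx G (λ _ → 0ℚ) i ≡ 0ℚ
AIx-0 G i = ≡-trans (cong (_+ 0ℚ) (sumℚ-zeros (λ j → *-zeroʳ (A G i j)))) (+-identityʳ 0ℚ)

x≤AIx : ∀ {n} (G : Graph n) (x : Vecℚ n) → (∀ j → 0ℚ ≤ x j) → ∀ i → x i ≤ AIx G x i
x≤AIx G x 0≤x i = subst (_≤ AIx G x i) (+-identityˡ (x i))
  (+-monoˡ-≤ (x i) (sumℚ-nonNeg (λ j → A*-nonNeg G i j (0≤x j))))

module _ {n₁ n₂} (G₁ : Graph n₁) (G₂ : Graph n₂) where

  A-⊔-ˡˡ : ∀ i j → A (G₁ ⊔ G₂) (i ↑ˡ n₂) (j ↑ˡ n₂) ≡ A G₁ i j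
  A-⊔-ˡˡ i j rewrite splitAt-↑ˡ n₁ i n₂ | splitAt-↑ˡ n₁ j n₂ = refl

  A-⊔-ˡʳ : ∀ i j → A (G₁ ⊔ G₂) (i ↑ˡ n₂) (n₁ ↑ʳ j) ≡ 0ℚ
  A-⊔-ˡʳ i j rewrite splitAt-↑ˡ n₁ i n₂ | splitAt-↑ʳ n₁ n₂ j = refl

  A-⊔-ʳˡ : ∀ i j → A (G₁ ⊔ G₂) (n₁ ↑ʳ i) (j ↑ˡ n₂) ≡ 0ℚ
  A-⊔-ʳˡ i j rewrite splitAt-↑ʳ n₁ n₂ i | splitAt-↑ˡ n₁ j n₂ = refl

  A-⊔-ʳʳ : ∀ i j → A (G₁ ⊔ G₂) (n₁ ↑ʳ i) (n₁ ↑ʳ j) ≡ A G₂ i j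
  A-⊔-ʳʳ i j rewrite splitAt-↑ʳ n₁ n₂ i | splitAt-↑ʳ n₁ n₂ j = refl

  AIx-⊔-↑ˡ : ∀ x i → AIx (G₁ ⊔ G₂) x (i ↑ˡ n₂) ≡ AIx G₁ (x ∘ (_↑ˡ n₂)) i
  AIx-⊔-↑ˡ x i = cong (_+ x (i ↑ˡ n₂)) (≡-trans
    (sumℚ-↑ˡ n₁ _ (λ j → ≡-trans (cong (_* x (n₁ ↑ʳ j)) (A-⊔-ˡʳ i j)) (*-zeroˡ (x (n₁ ↑ʳ j)))))
    (sumℚ-cong (λ j → cong (_* x (j ↑ˡ n₂)) (A-⊔-ˡˡ i j))))

  AIx-⊔-↑ʳ : ∀ x i → AIx (G₁ ⊔ G₂) x (n₁ ↑ʳ i) ≡ AIx G₂ (x ∘ (n₁ ↑ʳ_)) i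
  AIx-⊔-↑ʳ x i = cong (_+ x (n₁ ↑ʳ i)) (≡-trans
    (sumℚ-↑ʳ n₁ _ (λ j → ≡-trans (cong (_* x (j ↑ˡ n₂)) (A-⊔-ʳˡ i j)) (*-zeroˡ (x (j ↑ˡ n₂)))))
    (sumℚ-cong (λ j → cong (_* x (n₁ ↑ʳ j)) (A-⊔-ʳʳ i j))))

AIx-Gσ : ∀ {n} (G : Graph n) (x : Vecℚ n) → (∀ j → 0ℚ ≤ x j)
  → ∀ k → AIx (Gσ G x) (xσ x) k ≡ AIx G x (supportEmb x k)
AIx-Gσ G x 0≤x k = cong (_+ xσ x k) (sumℚ-supportEmb x (λ j → A G (supportEmb x k) j * x j) vanish)
  where
  vanish : ∀ j → ¬ σ x j → A G (supportEmb x k) j * x j ≡ 0ℚ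
  vanish j j∉σ = ≡-trans (cong (A G (supportEmb x k) j *_) (≤-antisym (≮⇒≥ j∉σ) (0≤x j))) (*-zeroʳ (A G (supportEmb x k) j))

Complementary : ℚ → ℚ → Set
Complementary p q = (0ℚ ≤ p) × (1ℚ ≤ q) × (p * (q - 1ℚ) ≡ 0ℚ)

SOL⇒Complementary : ∀ {n} (G : Graph n) (x : Vecℚ n) → SOL G x → ∀ i → Complementary (x i) (AIx G x i)
SOL⇒Complementary G x (0≤x , 1≤AIx , Σ≡0) i = 0≤x i , 1≤AIx i ,
  sumℚ-nonNeg-≡0 (λ j → *-nonNeg (0≤x j) (p≤q⇒0≤q-p (1≤AIx j))) Σ≡0 i

Complementary⇒SOL : ∀ {n} (G : Graph n) (x : Vecℚ n) → (∀ i → Complementary (x i) (AIx G x i)) → SOL G x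
Complementary⇒SOL G x c = proj₁ ∘ c , proj₁ ∘ proj₂ ∘ c , sumℚ-zeros (proj₂ ∘ proj₂ ∘ c)

0∉SOL : ∀ {n} (G : Graph (suc n)) → ¬ SOL G (λ _ → 0ℚ)
0∉SOL G (_ , 1≤AI0 , _) = <-irrefl refl (≤-<-trans (subst (1ℚ ≤_) (AIx-0 G zero) (1≤AI0 zero)) 0<1)

SOL⇒≤1 : ∀ {n} (G : Graph n) (x : Vecℚ n) → SOL G x → ∀ i → x i ≤ 1ℚ
SOL⇒≤1 G x sol i = p[q-1]≡0∧p≤q⇒p≤1 (proj₂ (proj₂ (SOL⇒Complementary G x sol i))) (x≤AIx G x (proj₁ sol) i)

SOL⇒σ-dominating : ∀ {n} (G : Graph n) (x : Vecℚ n) → SOL G x → Dominating G (σ x)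
SOL⇒σ-dominating G x (0≤x , 1≤AIx , _) v with 0ℚ <? x v
... | yes v∈σ = inj₁ v∈σ
... | no  v∉σ = inj₂ (map id (A*-pos⇒adj∧pos G) (sumℚ-pos⇒∃pos _ 0<Ax))
  where
  open ≤-Reasoning
  Ax = sumℚ (λ j → A G v j * x j)
  0<Ax : 0ℚ < Ax
  0<Ax = begin-strict
    0ℚ        <⟨ 0<1 ⟩
    1ℚ        ≤⟨ 1≤AIx v ⟩
    Ax + x v  ≡⟨ cong (Ax +_) (≤-antisym (≮⇒≥ v∉σ) (0≤x v)) ⟩
    Ax + 0ℚ   ≡⟨ +-identityʳ Ax ⟩
    Ax        ∎

SOL⇒SOL-Gσ : ∀ {n} (G : Graph n) (x : Vecℚ n) → SOL G x → SOL (Gσ G x) (xσ x)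
SOL⇒SOL-Gσ G x sol = Complementary⇒SOL (Gσ G x) (xσ x) λ k →
  subst (Complementary (xσ x k)) (≡-sym (AIx-Gσ G x (proj₁ sol) k)) (SOL⇒Complementary G x sol (supportEmb x k))

SOL-⊔⇔ : ∀ n₁ n₂ (G₁ : Graph n₁) (G₂ : Graph n₂) (x : Vecℚ (n₁ ℕ.+ n₂))
  → SOL (G₁ ⊔ G₂) x ⇔ (SOL G₁ (λ i → x (i ↑ˡ n₂)) × SOL G₂ (λ j → x (n₁ ↑ʳ j)))
SOL-⊔⇔ n₁ n₂ G₁ G₂ x = mk⇔ split join
  where
  G = G₁ ⊔ G₂
  x₁ = x ∘ (_↑ˡ n₂)
  x₂ = x ∘ (n₁ ↑ʳ_)

  split : SOL G x → SOL G₁ x₁ × SOL G₂ x₂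
  split sol =
      Complementary⇒SOL G₁ x₁ (λ i → subst (Complementary (x₁ i)) (AIx-⊔-↑ˡ G₁ G₂ x i) (c (i ↑ˡ n₂)))
    , Complementary⇒SOL G₂ x₂ (λ j → subst (Complementary (x₂ j)) (AIx-⊔-↑ʳ G₁ G₂ x j) (c (n₁ ↑ʳ j)))
    where c = SOL⇒Complementary G x sol

  join : SOL G₁ x₁ × SOL G₂ x₂ → SOL G x
  join (sol₁ , sol₂) = Complementary⇒SOL G x (↑-elim (λ k → Complementary (x k) (AIx G x k))
    (λ i → subst (Complementary (x₁ i)) (≡-sym (AIx-⊔-↑ˡ G₁ G₂ x i)) (SOL⇒Complementary G₁ x₁ sol₁ i))
    (λ j → subst (Complementary (x₂ j)) (≡-sym (AIx-⊔-↑ʳ G₁ G₂ x j)) (SOL⇒Complementary G₂ x₂ sol₂ j)))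

lemma1 : ∀ (n : ℕ) → 1 ℕ.≤ n → (G : Graph n)
    → (¬ SOL G (λ _ → 0ℚ))
    × (∀ x → SOL G x → ∀ i → x i ≤ AIx G x i)
    × (∀ x → SOL G x → ∀ i → (0ℚ ≤ x i) × (x i ≤ 1ℚ))
    × (∀ x → SOL G x → Dominating G (σ x))
    × (∀ x → SOL G x → SOL (Gσ G x) (xσ x) × (∀ k → σ (xσ x) k))
    × (∀ (n₁ n₂ : ℕ) (G₁ : Graph n₁) (G₂ : Graph n₂) (x : Vecℚ (n₁ ℕ.+ n₂))
         → SOL (G₁ ⊔ G₂) x ⇔ (SOL G₁ (λ i → x (i ↑ˡ n₂)) × SOL G₂ (λ j → x (n₁ ↑ʳ j))))
lemma1 (suc _) (s≤s z≤n) G =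
    0∉SOL G
  , (λ x sol → x≤AIx G x (proj₁ sol))
  , (λ x sol i → proj₁ sol i , SOL⇒≤1 G x sol i)
  , SOL⇒σ-dominating G
  , (λ x sol → SOL⇒SOL-Gσ G x sol , σ-xσ x)
  , SOL-⊔⇔
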